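{- Let $G=(V,E)$ be a connected finite simple graph with $n=|V|$, let $k$ be the largest cardinality of an independent set of $G$, and let $\mathcal G$ be the graph constructed from $G$ as described in the context. Then $\mathcal G$ contains a skew stalled subset of cardinality $(2n+1)|E|+k$.
   Context: For a finite simple graph $H$ with vertex set $W$ and a set $F\subseteq W$: an empty vertex $v\in W\setminus F$ is skew forced by $F$ if there is $u\in W$ (not necessarily in $F$) such that $v$ is the unique neighbor of $u$ outside $F$. $F$ is skew stalled if no vertex of $W\setminus F$ is skew forced by $F$. Construction of $\mathcal G$: given $G=(V,E)$ with $n=|V|$, let $E^i=\{e^i : e\in E\}$ for $i=0,1,\dots,2n$ be $2n+1$ pairwise disjoint copies of $E$ (disjoint from $V$), and let $\varepsilon$ be a further new vertex. The vertex set of $\mathcal G$ is $\mathcal V=V\cup E^0\cup\dots\cup E^{2n}\cup\{\varepsilon\}$. The edges of $\mathcal G$ are exactly: for every edge $e=\{u,v\}\in E$, the edges $\{u,e^0\}$ and $\{e^0,v\}$; the edges $\{e^i,e^{i+1}\}$ for $0\le i\le 2n-1$; and the edge $\{\varepsilon,e^0\}$. -}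

module Defs where

open import Data.Nat using (ℕ; zero; suc; _+_; _*_; _≤_)
open import Data.Fin using (Fin; zero; suc; inject₁)
open import Data.Product using (Σ; ∃; _×_; _,_; proj₁; proj₂)
open import Data.Sum using (_⊎_)
open import Data.List using (List; length; lookup)
open import Data.List.Relation.Unary.All using (All)
open import Data.List.Relation.Unary.Any using (Any)
open import Data.List.Relation.Unary.AllPairs using (AllPairs)
open import Data.List.Relation.Unary.Unique.Propositional using (Unique)
open import Data.List.Membership.Propositional using (_∈_; _∉_)
open import Relation.Nullary using (¬_)
open import Relation.Binary.PropositionalEquality using (_≡_; _≢_)

SameEdge : ∀ {n} → (Fin n × Fin n) → (Fin n × Fin n) → Set
SameEdge (a , b) (c , d) = (a ≡ c × b ≡ d) ⊎ (a ≡ d × b ≡ c)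

record SimpleGraph (n : ℕ) : Set where
  field
    edges    : List (Fin n × Fin n)
    noLoop   : All (λ e → proj₁ e ≢ proj₂ e) edges
    distinct : AllPairs (λ e f → ¬ SameEdge e f) edges

open SimpleGraph public

numEdges : ∀ {n} → SimpleGraph n → ℕ
numEdges G = length (edges G)

Adj : ∀ {n} → SimpleGraph n → Fin n → Fin n → Set
Adj G u v = Any (λ e → SameEdge e (u , v)) (edges G)

data Reach {n} (G : SimpleGraph n) : Fin n → Fin n → Set where
  here : ∀ {u} → Reach G u u
  step : ∀ {u v w} → Adj G u v → Reach G v w → Reach G u w

Connected : ∀ {n} → SimpleGraph n → Set
Connected {n} G = (u v : Fin n) → Reach G u v

IsIndependent : ∀ {n} → SimpleGraph n → List (Fin n) → Set
IsIndependent G I = Unique I × AllPairs (λ a b → ¬ Adj G a b) I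

IsIndependenceNumber : ∀ {n} → SimpleGraph n → ℕ → Set
IsIndependenceNumber G k =
  (∃ λ I → IsIndependent G I × length I ≡ k) ×
  (∀ I → IsIndependent G I → length I ≤ k)

-- The construction 𝒢 from G.
-- Vertices: V ⊎ (copies e^i, i = 0..2n, e indexed by its position in the
-- edge list) ⊎ {ε}.

data GVert (n m : ℕ) : Set where
  vtx : Fin n → GVert n m
  cp  : Fin (suc (2 * n)) → Fin m → GVert n m
  eps : GVert n m

data GEdge {n} (G : SimpleGraph n) : GVert n (numEdges G) → GVert n (numEdges G) → Set where
  ve₁ : ∀ j u → proj₁ (lookup (edges G) j) ≡ u → GEdge G (vtx u) (cp zero j)
  ve₂ : ∀ j v → proj₂ (lookup (edges G) j) ≡ v → GEdge G (cp zero j) (vtx v)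
  ee  : ∀ (i : Fin (2 * n)) j → GEdge G (cp (inject₁ i) j) (cp (suc i) j)
  εe  : ∀ j → GEdge G eps (cp zero j)

GAdj : ∀ {n} (G : SimpleGraph n) → GVert n (numEdges G) → GVert n (numEdges G) → Set
GAdj G x y = GEdge G x y ⊎ GEdge G y x

SkewForced : {W : Set} → (W → W → Set) → List W → W → Set
SkewForced {W} A F v =
  v ∉ F × Σ W (λ u → A u v × (∀ w → A u w → w ∉ F → w ≡ v))

SkewStalled : {W : Set} → (W → W → Set) → List W → Set
SkewStalled {W} A F = (v : W) → ¬ SkewForced A F v

-- Take F to be all 2n+1 copies of E together with a maximum independent set I of G.
-- The empty vertices are then ε and the vertices of G outside I, and every vertex adjacent
-- to one of them is some e⁰. But e⁰ sees ε, and, I being independent, also an endpoint of e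
-- outside I: two empty neighbours, so e⁰ forces nothing.
module Submission where

open import Defs
open import Data.Nat using (ℕ; suc; _+_; _*_)
open import Data.Fin using (Fin; zero; _≟_)
open import Data.Product using (∃; ∃₂; _×_; _,_; proj₁; proj₂)
open import Data.Sum using (_⊎_; inj₁; inj₂; [_,_]′)
open import Data.Empty using (⊥-elim)
open import Data.List using (List; []; _∷_; _++_; map; cartesianProductWith; allFin; length; lookup)
open import Data.List.Properties using (length-++; length-map; length-tabulate)
import Data.List.Relation.Unary.Any as Any
open import Data.List.Relation.Unary.Any using (here; there)
import Data.List.Relation.Unary.All as All
open import Data.List.Relation.Unary.AllPairs using (AllPairs; _∷_)
open import Data.List.Relation.Unary.Unique.Propositional using (Unique)
import Data.List.Relation.Unary.Unique.Propositional.Properties as Unique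
open import Data.List.Membership.Propositional using (_∈_; _∉_)
open import Data.List.Membership.Propositional.Properties
  using (∈-++⁺ˡ; ∈-++⁻; ∈-map⁻; ∈-allFin; ∈-lookup; ∈-cartesianProductWith⁺; ∈-cartesianProductWith⁻)
open import Relation.Nullary using (¬_; yes; no)
open import Relation.Binary.PropositionalEquality using (_≡_; _≢_; refl; sym; trans; cong; cong₂)

length-cartesianProductWith : ∀ {A B C : Set} (f : A → B → C) (xs : List A) (ys : List B) →
  length (cartesianProductWith f xs ys) ≡ length xs * length ys
length-cartesianProductWith f []       ys = refl
length-cartesianProductWith f (x ∷ xs) ys = trans (length-++ (map (f x) ys))
  (cong₂ _+_ (length-map (f x) ys) (length-cartesianProductWith f xs ys))

AllPairs-∈ : ∀ {A : Set} {R : A → A → Set} {xs : List A} {a b : A} →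
  AllPairs R xs → a ∈ xs → b ∈ xs → a ≢ b → R a b ⊎ R b a
AllPairs-∈ (_  ∷ _)  (here refl) (here refl) a≢b = ⊥-elim (a≢b refl)
AllPairs-∈ (px ∷ _)  (here refl) (there b∈) _   = inj₁ (All.lookup px b∈)
AllPairs-∈ (px ∷ _)  (there a∈)  (here refl) _  = inj₂ (All.lookup px a∈)
AllPairs-∈ (_  ∷ ps) (there a∈)  (there b∈) a≢b = AllPairs-∈ ps a∈ b∈ a≢b

TwoEmptyNeighbours : {W : Set} → (W → W → Set) → List W → W → Set
TwoEmptyNeighbours A F u = ∃₂ λ w w′ → w ≢ w′ × (A u w × w ∉ F) × (A u w′ × w′ ∉ F)

twoEmptyNeighbours⇒skewStalled : {W : Set} (A : W → W → Set) (F : List W) →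
  (∀ {u v} → A u v → v ∉ F → TwoEmptyNeighbours A F u) → SkewStalled A F
twoEmptyNeighbours⇒skewStalled A F two v (v∉F , u , uv , onlyEmpty)
  with w , w′ , w≢w′ , (uw , w∉F) , (uw′ , w′∉F) ← two uv v∉F
  = w≢w′ (trans (onlyEmpty w uw w∉F) (sym (onlyEmpty w′ uw′ w′∉F)))

module _ {n : ℕ} (G : SimpleGraph n) where
  open import Data.List.Membership.DecPropositional (_≟_ {n}) using (_∈?_)

  private
    m : ℕ
    m = numEdges G

    src tgt : Fin m → Fin n
    src j = proj₁ (lookup (edges G) j)
    tgt j = proj₂ (lookup (edges G) j)

  Adj-sym : ∀ {u v} → Adj G u v → Adj G v u
  Adj-sym = Any.map λ { (inj₁ (p , q)) → inj₂ (p , q) ; (inj₂ (p , q)) → inj₁ (p , q) }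

  endpoints-adjacent : ∀ j → Adj G (src j) (tgt j)
  endpoints-adjacent j = Any.map (λ { refl → inj₁ (refl , refl) }) (∈-lookup j)

  independent-misses-endpoint : ∀ {I} → AllPairs (λ a b → ¬ Adj G a b) I →
    ∀ j → src j ∉ I ⊎ tgt j ∉ I
  independent-misses-endpoint {I} independent j with src j ∈? I | tgt j ∈? I
  ... | no src∉I | _        = inj₁ src∉I
  ... | yes _    | no tgt∉I = inj₂ tgt∉I
  ... | yes src∈I | yes tgt∈I =
    ⊥-elim ([ (λ ¬adj → ¬adj (endpoints-adjacent j)) , (λ ¬adj → ¬adj (Adj-sym (endpoints-adjacent j))) ]′
      (AllPairs-∈ independent src∈I tgt∈I (All.lookup (noLoop G) (∈-lookup j))))

  copies : List (GVert n m)
  copies = cartesianProductWith cp (allFin (suc (2 * n))) (allFin m)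

  stalledSet : List (Fin n) → List (GVert n m)
  stalledSet I = copies ++ map vtx I

  cp∈stalledSet : ∀ I i j → cp i j ∈ stalledSet I
  cp∈stalledSet I i j = ∈-++⁺ˡ (∈-cartesianProductWith⁺ cp (∈-allFin i) (∈-allFin j))

  ∉copies : ∀ {x} → (∀ i j → x ≢ cp i j) → x ∉ copies
  ∉copies x≢cp x∈ with _ , _ , _ , _ , x≡cp ← ∈-cartesianProductWith⁻ cp (allFin (suc (2 * n))) (allFin m) x∈ = x≢cp _ _ x≡cp

  vtx∉copies : ∀ {a} → vtx a ∉ copies
  vtx∉copies = ∉copies (λ _ _ ())

  eps∉stalledSet : ∀ I → eps ∉ stalledSet I
  eps∉stalledSet I eps∈ with ∈-++⁻ copies eps∈
  ... | inj₁ eps∈copies = ∉copies (λ _ _ ()) eps∈copies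
  ... | inj₂ eps∈vtxs with _ , _ , () ← ∈-map⁻ vtx eps∈vtxs

  vtx∈stalledSet⁻ : ∀ {I a} → vtx a ∈ stalledSet I → a ∈ I
  vtx∈stalledSet⁻ vtx∈ with ∈-++⁻ copies vtx∈
  ... | inj₁ vtx∈copies = ⊥-elim (vtx∉copies vtx∈copies)
  ... | inj₂ vtx∈vtxs with _ , a∈I , refl ← ∈-map⁻ vtx vtx∈vtxs = a∈I

  stalledSet-unique : ∀ {I} → Unique I → Unique (stalledSet I)
  stalledSet-unique {I} uniqueI = Unique.++⁺
    (Unique.cartesianProductWith⁺ cp (λ { refl → refl , refl }) (Unique.allFin⁺ _) (Unique.allFin⁺ _))
    (Unique.map⁺ (λ { refl → refl }) uniqueI)
    disjoint
    where
    disjoint : ∀ {x} → ¬ (x ∈ copies × x ∈ map vtx I)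
    disjoint (x∈copies , x∈vtxs) with _ , _ , refl ← ∈-map⁻ vtx x∈vtxs = vtx∉copies x∈copies

  length-stalledSet : ∀ I → length (stalledSet I) ≡ suc (2 * n) * m + length I
  length-stalledSet I = trans (length-++ copies)
    (cong₂ _+_
      (trans (length-cartesianProductWith cp (allFin (suc (2 * n))) (allFin m))
             (cong₂ _*_ (length-tabulate {n = suc (2 * n)} (λ i → i)) (length-tabulate {n = m} (λ j → j))))
      (length-map vtx I))

  emptyNeighbour⇒hub : ∀ {I u v} → GAdj G u v → v ∉ stalledSet I → ∃ λ j → u ≡ cp zero j
  emptyNeighbour⇒hub (inj₁ (ve₂ j _ _)) _   = j , refl
  emptyNeighbour⇒hub (inj₂ (ve₁ j _ _)) _   = j , refl
  emptyNeighbour⇒hub (inj₂ (εe j))      _   = j , refl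
  emptyNeighbour⇒hub {I} (inj₁ (ve₁ j _ _)) v∉ = ⊥-elim (v∉ (cp∈stalledSet I _ j))
  emptyNeighbour⇒hub {I} (inj₁ (ee i j))    v∉ = ⊥-elim (v∉ (cp∈stalledSet I _ j))
  emptyNeighbour⇒hub {I} (inj₁ (εe j))      v∉ = ⊥-elim (v∉ (cp∈stalledSet I _ j))
  emptyNeighbour⇒hub {I} (inj₂ (ve₂ j _ _)) v∉ = ⊥-elim (v∉ (cp∈stalledSet I _ j))
  emptyNeighbour⇒hub {I} (inj₂ (ee i j))    v∉ = ⊥-elim (v∉ (cp∈stalledSet I _ j))

  hub-twoEmptyNeighbours : ∀ {I} → IsIndependent G I →
    ∀ j → TwoEmptyNeighbours (GAdj G) (stalledSet I) (cp zero j)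
  hub-twoEmptyNeighbours {I} (_ , independent) j with independent-misses-endpoint independent j
  ... | inj₁ src∉I = eps , vtx (src j) , (λ ()) , (inj₂ (εe j) , eps∉stalledSet I) ,
                     (inj₂ (ve₁ j _ refl) , λ src∈ → src∉I (vtx∈stalledSet⁻ src∈))
  ... | inj₂ tgt∉I = eps , vtx (tgt j) , (λ ()) , (inj₂ (εe j) , eps∉stalledSet I) ,
                     (inj₁ (ve₂ j _ refl) , λ tgt∈ → tgt∉I (vtx∈stalledSet⁻ tgt∈))

  stalledSet-skewStalled : ∀ {I} → IsIndependent G I → SkewStalled (GAdj G) (stalledSet I)
  stalledSet-skewStalled {I} independent = twoEmptyNeighbours⇒skewStalled (GAdj G) (stalledSet I) two
    where
    two : ∀ {u v} → GAdj G u v → v ∉ stalledSet I → TwoEmptyNeighbours (GAdj G) (stalledSet I) u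
    two uv v∉ with j , refl ← emptyNeighbour⇒hub uv v∉ = hub-twoEmptyNeighbours independent j

mainTheorem3 : (n : ℕ) (G : SimpleGraph n) → Connected G →
    (k : ℕ) → IsIndependenceNumber G k →
    ∃ λ F → Unique F × SkewStalled (GAdj G) F ×
    length F ≡ suc (2 * n) * numEdges G + k
mainTheorem3 n G _ k ((I , independent , |I|≡k) , _) =
  stalledSet G I ,
  stalledSet-unique G (proj₁ independent) ,
  stalledSet-skewStalled G independent ,
  trans (length-stalledSet G I) (cong (suc (2 * n) * numEdges G +_) |I|≡k)
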